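{- For every integer $d_2\ge 4$, in the game $i\textsc{ -Mark}(\{1\},\{2,d_2\})$ convergence occurs in at most $4d_2+3$ steps; that is, for every starting position $n\ge 0$ there is some $c'$ with $1\le c'\le 4d_2+3$ such that convergence occurs in $c'$ steps starting at $n$.
   Context: For sets $S,D$ of positive integers with $\min D\ge 2$, the impartial game $i\textsc{ -Mark}(S,D)$ has positions $n\in\mathbb N=\{0,1,2,\dots\}$; from $n$ one may move to $n-s$ for any $s\in S$ with $n-s\ge 0$ (a subtraction follower), and to $n/d$ for any $d\in D$ with $n>0$ and $d\mid n$ (a division follower). $\mathcal G$ denotes the Sprague--Grundy function: $\mathcal G(n)=\operatorname{mex}\{\mathcal G(w): w \text{ a follower of } n\}$, where $\operatorname{mex} A=\min(\mathbb N\setminus A)$. Let $\varphi(n)$ be the number of followers of $n$ and $s=\max S$. A guess seed for starting position $n$ is a tuple $\overline\sigma=(\sigma_n,\dots,\sigma_{n+s-1})$ of integers with $0\le\sigma_i\le\varphi(i)$; $\Sigma_n$ is the set of all such seeds. The guess sequence $\mathcal G_{\overline\sigma}$ is defined by $\mathcal G_{\overline\sigma}(i)=\sigma_i$ for $n\le i<n+s$ and, for $m\ge n+s$, $\mathcal G_{\overline\sigma}(m)=\operatorname{mex}\big(\{\mathcal G_{\overline\sigma}(m-t): t\in S\}\cup\{\mathcal G(m/d): d\in D,\ d\mid m\}\big)$. Convergence occurs in $c$ steps starting at position $n$ if $c\ge s$ and $\mathcal G_{\overline\sigma}(m)=\mathcal G_{\overline\sigma'}(m)$ for all $\overline\sigma,\overline\sigma'\in\Sigma_n$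 and all $n+c\le m<n+c+s$. For a game, convergence occurs in $c$ steps if for every starting position $n$ convergence occurs in at most $c$ steps. -}

module Defs where

open import Data.Nat using (ℕ; zero; suc; _+_; _≤_; _≟_)
open import Data.Nat.Divisibility using (_∣_; _∣?_; quotient)
open import Data.List using (List; []; _∷_; _++_; length; deduplicate; map)
open import Data.List.Membership.DecPropositional _≟_ using (_∈?_)
open import Data.Product using (Σ; ∃; _×_; _,_)
open import Relation.Nullary using (yes; no)
open import Relation.Binary.PropositionalEquality using (_≡_)

-- Candidates 0,1,2,... are tested in order; with fuel = length l this is
-- exact (if 0..length l - 1 all occur, the list is exhausted, so length l
-- does not occur).
mexGo : List ℕ → ℕ → ℕ → ℕ
mexGo l zero k = k
mexGo l (suc f) k with k ∈? l
... | yes _ = mexGo l f (suc k)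
... | no _ = k

mex : List ℕ → ℕ
mex l = mexGo l (length l) 0

-- Division followers of n (n > 0): n/d for each d ∈ D with d ∣ n.
-- We only call this with n > 0.  D is given as a list.
divFollowers : List ℕ → ℕ → List ℕ
divFollowers [] n = []
divFollowers (d ∷ D) n with d ∣? n
... | yes d∣n = quotient d∣n ∷ divFollowers D n
... | no _ = divFollowers D n

followers : List ℕ → ℕ → List ℕ
followers D zero = []
followers D (suc m) = m ∷ divFollowers D (suc m)

φ : List ℕ → ℕ → ℕ
φ D n = length (deduplicate _≟_ (followers D n))

-- Sprague–Grundy function, by recursion on a fuel parameter; every follower
-- of n is < n, so fuel n suffices (G D n = Gf D n n).
Gf : List ℕ → ℕ → ℕ → ℕ
Gf D zero n = zero
Gf D (suc f) n = mex (map (Gf D f) (followers D n))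

G : List ℕ → ℕ → ℕ
G D n = Gf D n n

-- Guess sequence for i-Mark({1}, D) (s = max S = 1) with seed σ = σ_n at
-- starting position n:  guessSeq D n σ k = G_σ(n + k).
guessSeq : List ℕ → ℕ → ℕ → ℕ → ℕ
guessSeq D n σ zero = σ
guessSeq D n σ (suc k) =
  mex (guessSeq D n σ k ∷ map (G D) (divFollowers D (n + suc k)))

-- Convergence occurs in c steps starting at n (here s = 1, so the window
-- n+c ≤ m < n+c+1 is the single position m = n + c, and seeds are single
-- values σ with 0 ≤ σ ≤ φ(n)).
ConvergesIn : List ℕ → ℕ → ℕ → Set
ConvergesIn D n c =
  (1 ≤ c) ×
  ((σ σ' : ℕ) → σ ≤ φ D n → σ' ≤ φ D n →
     guessSeq D n σ c ≡ guessSeq D n σ' c)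

{-# OPTIONS --safe #-}
-- Let n be a start position and x a P-position (G x = 0) slightly above n/2; such an x
-- exists because P-positions are dense: at an odd m with no division followers the
-- only follower is m - 1, so G (m - 1) = 0 or G m = 0, and since d ∤ 2 one of any
-- two consecutive odd numbers avoids d.  At 2x the move to x = 2x/2 puts 0 into the
-- mex, so every guess sequence is nonzero there.  Among 2x+1, 2x+3 one position has
-- no division followers, and the first position after 2x without a division follower
-- of Grundy value 0 is reached from a nonzero guess, so every seed yields 0 there.
-- This happens at most 13 steps after n, whatever d is.
module Submission where

open import Defs
open import Data.Nat using (ℕ; zero; suc; _+_; _*_; _≤_; _<_; _≟_; z≤n; s≤s; NonZero)
open import Data.Nat.Properties
open import Data.Nat.Divisibility using (_∣_; _∤_; _∣?_; quotient; n∣m*n; ∣m+n∣m⇒∣n; ∣1⇒≡1; >⇒∤)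
open import Data.Nat.Tactic.RingSolver using (solve-∀)
open import Algebra.Properties.CommutativeSemigroup +-commutativeSemigroup using (x∙yz≈y∙xz)
open import Data.List using (List; []; _∷_; map; length)
open import Data.List.Relation.Unary.All using (All; []; _∷_)
open import Data.List.Relation.Unary.Any using (here; there)
open import Data.List.Membership.DecPropositional _≟_ using (_∈_; _∉_; _∈?_)
open import Data.List.Membership.Propositional.Properties using (∈-map⁺)
open import Data.Product using (Σ; _×_; _,_; ∃-syntax)
open import Data.Sum using (_⊎_; inj₁; inj₂)
open import Relation.Nullary using (yes; no; contradiction)
open import Relation.Binary.PropositionalEquality using (_≡_; _≢_; refl; sym; trans; cong; subst; module ≡-Reasoning)

k≤mexGo : ∀ l f k → k ≤ mexGo l f k
k≤mexGo l zero k = ≤-refl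
k≤mexGo l (suc f) k with k ∈? l
... | yes _ = ≤-trans (n≤1+n k) (k≤mexGo l f (suc k))
... | no _ = ≤-refl

0∉⇒mex≡0 : ∀ {l} → 0 ∉ l → mex l ≡ 0
0∉⇒mex≡0 {[]} _ = refl
0∉⇒mex≡0 {l@(_ ∷ _)} 0∉l with 0 ∈? l
... | yes 0∈l = contradiction 0∈l 0∉l
... | no _ = refl

0∈⇒mex≢0 : ∀ {l} → 0 ∈ l → mex l ≢ 0
0∈⇒mex≢0 {l@(_ ∷ ys)} 0∈l with 0 ∈? l
... | yes _ = λ mex≡0 → 1+n≰n (subst (1 ≤_) mex≡0 (k≤mexGo l (length ys) 1))
... | no 0∉l = contradiction 0∈l 0∉l

2∤odd : ∀ w → 2 ∤ suc (w * 2)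
2∤odd w 2∣odd = contradiction (∣1⇒≡1 (∣m+n∣m⇒∣n 2∣w*2+1 (n∣m*n w))) λ ()
  where
  2∣w*2+1 : 2 ∣ w * 2 + 1
  2∣w*2+1 = subst (2 ∣_) (+-comm 1 (w * 2)) 2∣odd

ceil-half : ∀ m → ∃[ w ] ∃[ j ] j ≤ 1 × w * 2 ≡ j + m
ceil-half zero = 0 , 0 , z≤n , refl
ceil-half (suc zero) = 1 , 1 , ≤-refl , refl
ceil-half (suc (suc m)) with ceil-half m
... | w , j , j≤1 , w*2≡j+m =
  suc w , j , j≤1 , trans (cong (2 +_) w*2≡j+m) (x∙yz≈y∙xz 2 j m)

divisionValues : List ℕ → ℕ → List ℕ
divisionValues D m = map (G D) (divFollowers D m)

divFollowers≡[] : ∀ {D m} → All (_∤ m) D → divFollowers D m ≡ []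
divFollowers≡[] [] = refl
divFollowers≡[] {d ∷ _} {m} (d∤m ∷ D∤m) with d ∣? m
... | yes d∣m = contradiction d∣m d∤m
... | no _ = divFollowers≡[] D∤m

∈-divFollowers : ∀ {d D} q .{{_ : NonZero d}} → d ∈ D → q ∈ divFollowers D (q * d)
∈-divFollowers {d} q (here refl) with d ∣? q * d
... | yes d∣q*d = here (*-cancelʳ-≡ q (quotient d∣q*d) d (_∣_.equality d∣q*d))
... | no d∤q*d = contradiction (n∣m*n q) d∤q*d
∈-divFollowers {d} {d′ ∷ _} q (there d∈D) with d′ ∣? q * d
... | yes _ = there (∈-divFollowers q d∈D)
... | no _ = ∈-divFollowers q d∈D

G≡0⊎G-suc≡0 : ∀ D m → divFollowers D (suc m) ≡ [] → G D m ≡ 0 ⊎ G D (suc m) ≡ 0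
G≡0⊎G-suc≡0 D m none with G D m ≟ 0
... | yes Gm≡0 = inj₁ Gm≡0
... | no Gm≢0 = inj₂ (begin
  G D (suc m)       ≡⟨ cong (λ fs → mex (G D m ∷ map (Gf D m) fs)) none ⟩
  mex (G D m ∷ [])  ≡⟨ 0∉⇒mex≡0 (λ { (here 0≡Gm) → Gm≢0 (sym 0≡Gm) ; (there ()) }) ⟩
  0                 ∎)
  where open ≡-Reasoning

module _ (D : List ℕ) (n : ℕ) where

  SeedsNonzeroAt : ℕ → Set
  SeedsNonzeroAt k = ∀ σ → guessSeq D n σ k ≢ 0

  SeedsVanishAt : ℕ → Set
  SeedsVanishAt k = ∀ σ → guessSeq D n σ k ≡ 0

  seedsNonzeroAt : ∀ {k} → 0 < k → 0 ∈ divisionValues D (n + k) → SeedsNonzeroAt k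
  seedsNonzeroAt {suc k} _ 0∈ σ = 0∈⇒mex≢0 (there {x = guessSeq D n σ k} 0∈)

  seedsVanishAt-suc : ∀ {k} → SeedsNonzeroAt k → 0 ∉ divisionValues D (n + suc k) → SeedsVanishAt (suc k)
  seedsVanishAt-suc nonzero 0∉ σ = 0∉⇒mex≡0 λ
    { (here 0≡guess) → nonzero σ (sym 0≡guess)
    ; (there 0∈) → 0∉ 0∈
    }

  seedsVanish-by : ∀ {k} j → k < j → SeedsNonzeroAt k → 0 ∉ divisionValues D (n + j) →
    ∃[ c ] k < c × c ≤ j × SeedsVanishAt c
  seedsVanish-by (suc j) k<1+j nonzero 0∉ with m<1+n⇒m<n∨m≡n k<1+j
  ... | inj₂ refl = suc j , ≤-refl , ≤-refl , seedsVanishAt-suc nonzero 0∉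
  ... | inj₁ k<j with 0 ∈? divisionValues D (n + j)
  ...   | yes 0∈ = suc j , k<1+j , ≤-refl , seedsVanishAt-suc (seedsNonzeroAt (≤-trans (s≤s z≤n) k<j) 0∈) 0∉
  ...   | no 0∉′ with seedsVanish-by j k<j nonzero 0∉′
  ...     | c , k<c , c≤j , vanish = c , k<c , m≤n⇒m≤1+n c≤j , vanish

module _ {d : ℕ} (d∤2 : d ∤ 2) where

  D : List ℕ
  D = 2 ∷ d ∷ []

  divFollowers-odd≡[] : ∀ w → d ∤ suc (w * 2) → divFollowers D (suc (w * 2)) ≡ []
  divFollowers-odd≡[] w d∤odd = divFollowers≡[] (2∤odd w ∷ d∤odd ∷ [])

  0∉divisionValues-odd : ∀ w → d ∤ suc (w * 2) → 0 ∉ divisionValues D (suc (w * 2))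
  0∉divisionValues-odd w d∤odd = subst (λ fs → 0 ∉ map (G D) fs) (sym (divFollowers-odd≡[] w d∤odd)) λ ()

  d∤odd⊎d∤next-odd : ∀ w → d ∤ suc (w * 2) ⊎ d ∤ suc (suc w * 2)
  d∤odd⊎d∤next-odd w with d ∣? suc (w * 2)
  ... | no d∤odd = inj₁ d∤odd
  ... | yes d∣odd = inj₂ λ d∣next → d∤2 (∣m+n∣m⇒∣n (subst (d ∣_) (+-comm 2 (suc (w * 2))) d∣next) d∣odd)

  ∃-odd-without-divFollowers : ∀ w → ∃[ h ] h ≤ 2 × divFollowers D (suc (h + w * 2)) ≡ []
  ∃-odd-without-divFollowers w with d∤odd⊎d∤next-odd w
  ... | inj₁ d∤odd = 0 , z≤n , divFollowers-odd≡[] w d∤odd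
  ... | inj₂ d∤next = 2 , ≤-refl , divFollowers-odd≡[] (suc w) d∤next

  ∃-P-position-near : ∀ a → ∃[ i ] i ≤ 4 × G D (i + a) ≡ 0
  ∃-P-position-near a with ceil-half a
  ... | w , j , j≤1 , w*2≡j+a with ∃-odd-without-divFollowers w
  ... | h , h≤2 , none =
    P-position-among (G≡0⊎G-suc≡0 D (h + j + a) (subst (λ m → divFollowers D (suc m) ≡ []) position none))
    where
    position : h + w * 2 ≡ h + j + a
    position = trans (cong (h +_) w*2≡j+a) (sym (+-assoc h j a))
    h+j≤3 : h + j ≤ 3
    h+j≤3 = +-mono-≤ h≤2 j≤1
    P-position-among : G D (h + j + a) ≡ 0 ⊎ G D (suc (h + j + a)) ≡ 0 → ∃[ i ] i ≤ 4 × G D (i + a) ≡ 0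
    P-position-among (inj₁ G≡0) = h + j , m≤n⇒m≤1+n h+j≤3 , G≡0
    P-position-among (inj₂ G≡0) = suc (h + j) , s≤s h+j≤3 , G≡0

  seedsVanish-after-double : ∀ n o x → n + suc o ≡ x * 2 → G D x ≡ 0 →
    ∃[ c ] suc o < c × c ≤ 4 + o × SeedsVanishAt D n c
  seedsVanish-after-double n o x n+1+o≡x*2 Gx≡0 = vanish (d∤odd⊎d∤next-odd x)
    where
    0∉at : ∀ {j m} → n + j ≡ m → 0 ∉ divisionValues D m → 0 ∉ divisionValues D (n + j)
    0∉at n+j≡m = subst (λ m → 0 ∉ divisionValues D m) (sym n+j≡m)

    0∈at-double : 0 ∈ divisionValues D (n + suc o)
    0∈at-double = subst (λ m → 0 ∈ divisionValues D m) (sym n+1+o≡x*2)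
      (subst (_∈ divisionValues D (x * 2)) Gx≡0 (∈-map⁺ (G D) (∈-divFollowers x (here refl))))

    nonzero : SeedsNonzeroAt D n (suc o)
    nonzero = seedsNonzeroAt D n (s≤s z≤n) 0∈at-double

    vanish : d ∤ suc (x * 2) ⊎ d ∤ suc (suc x * 2) → ∃[ c ] suc o < c × c ≤ 4 + o × SeedsVanishAt D n c
    vanish (inj₁ d∤odd) with seedsVanish-by D n (2 + o) ≤-refl nonzero
      (0∉at (trans (+-suc n (suc o)) (cong suc n+1+o≡x*2)) (0∉divisionValues-odd x d∤odd))
    ... | c , o<c , c≤2+o , vanishes = c , o<c , ≤-trans c≤2+o (m≤n+m (2 + o) 2) , vanishes
    vanish (inj₂ d∤next) = seedsVanish-by D n (4 + o) (m<n+m (suc o) {3} (s≤s z≤n)) nonzero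
      (0∉at n+4+o≡next-odd (0∉divisionValues-odd (suc x) d∤next))
      where
      n+4+o≡next-odd : n + (4 + o) ≡ suc (suc x * 2)
      n+4+o≡next-odd = trans (x∙yz≈y∙xz n 3 (suc o)) (cong (3 +_) n+1+o≡x*2)

  converges-within-13 : ∀ n → ∃[ c ] 1 ≤ c × c ≤ 13 × ConvergesIn D n c
  converges-within-13 n with ceil-half (suc n)
  ... | a , j , j≤1 , a*2≡j+1+n with ∃-P-position-near a
  ... | i , i≤4 , G≡0 = conclude (seedsVanish-after-double n (i * 2 + j) (i + a) position G≡0)
    where
    position : n + suc (i * 2 + j) ≡ (i + a) * 2
    position = begin
      n + suc (i * 2 + j)  ≡⟨ rearrange n i j ⟩
      i * 2 + (j + suc n)  ≡⟨ cong (i * 2 +_) a*2≡j+1+n ⟨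
      i * 2 + a * 2        ≡⟨ *-distribʳ-+ 2 i a ⟨
      (i + a) * 2          ∎
      where
      open ≡-Reasoning
      rearrange : ∀ n i j → n + suc (i * 2 + j) ≡ i * 2 + (j + suc n)
      rearrange = solve-∀

    conclude : ∃[ c ] suc (i * 2 + j) < c × c ≤ 4 + (i * 2 + j) × SeedsVanishAt D n c →
      ∃[ c ] 1 ≤ c × c ≤ 13 × ConvergesIn D n c
    conclude (c , o<c , c≤4+o , vanishes) =
      c , 1≤c , ≤-trans c≤4+o (+-monoʳ-≤ 4 (+-mono-≤ (*-monoˡ-≤ 2 i≤4) j≤1)) ,
      1≤c , λ σ σ′ _ _ → trans (vanishes σ) (sym (vanishes σ′))
      where
      1≤c : 1 ≤ c
      1≤c = ≤-trans (s≤s z≤n) o<c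

mainTheorem4 : (d₂ : ℕ) → 4 ≤ d₂ → (n : ℕ) →
    Σ ℕ (λ c′ → (1 ≤ c′) × (c′ ≤ 4 * d₂ + 3) × ConvergesIn (2 ∷ d₂ ∷ []) n c′)
mainTheorem4 d₂ 4≤d₂ n =
  let c , 1≤c , c≤13 , converges = converges-within-13 (>⇒∤ (≤-trans (n≤1+n 3) 4≤d₂)) n
  in c , 1≤c , ≤-trans c≤13 13≤4*d₂+3 , converges
  where
  13≤4*d₂+3 : 13 ≤ 4 * d₂ + 3
  13≤4*d₂+3 = ≤-trans (m≤m+n 13 6) (+-monoˡ-≤ 3 (*-monoʳ-≤ 4 4≤d₂))
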